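{- Let $\mathcal{FO}$ be the class of all forests. For all integers $k\geq1$, $i\geq k+3$ and $j\geq k+2$, we have $R_k^{\mathcal{FO}}(i,j)=j+\left\lfloor\dfrac{j-1}{k+1}\right\rfloor$.
   Context: All graphs are finite and simple. For a graph $G$ and an integer $k\ge 0$, a $k$-sparse $j$-set is a set of exactly $j$ vertices of $G$ inducing a subgraph of maximum degree at most $k$. A $k$-dense $i$-set is a set of exactly $i$ vertices that is $k$-sparse in the complement of $G$. For a graph class $\mathcal{G}$, $R_k^{\mathcal{G}}(i,j)$ is the smallest natural number $n$ such that every graph on $n$ vertices belonging to $\mathcal{G}$ has a $k$-dense $i$-set or a $k$-sparse $j$-set. A forest is a graph with no cycles. -}

module Defs where

open import Data.Nat using (ℕ; zero; suc; _+_; _∸_; _≤_; _<_; _/_)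
open import Data.Bool using (Bool; true; false; not; _∧_; T)
open import Data.Fin using (Fin; _≟_)
open import Data.List using (List; []; _∷_; length; filter; _++_)
open import Data.List.Relation.Unary.Unique.Propositional using (Unique)
open import Data.List.Relation.Unary.All using (All)
open import Data.Product using (Σ; _×_; _,_; ∃-syntax)
open import Relation.Binary.PropositionalEquality using (_≡_; refl; cong)
open import Relation.Nullary using (¬_)
open import Relation.Nullary.Decidable using (Dec; yes; no; ⌊_⌋; T?)

record Graph (n : ℕ) : Set where
  field
    adj    : Fin n → Fin n → Bool
    adj-sym    : ∀ u v → adj u v ≡ adj v u
    adj-irrefl : ∀ v → adj v v ≡ false
open Graph public

private
  neq : ∀ {n} → Fin n → Fin n → Bool
  neq u v = not ⌊ u ≟ v ⌋

  neq-sym : ∀ {n} (u v : Fin n) → neq u v ≡ neq v u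
  neq-sym u v with u ≟ v | v ≟ u
  ... | yes _ | yes _ = refl
  ... | no _  | no _  = refl
  ... | yes p | no q  = Relation.Nullary.contradiction (Relation.Binary.PropositionalEquality.sym p) q
    where import Relation.Nullary
  ... | no p  | yes q = Relation.Nullary.contradiction (Relation.Binary.PropositionalEquality.sym q) p
    where import Relation.Nullary

  neq-irrefl : ∀ {n} (v : Fin n) → neq v v ≡ false
  neq-irrefl v with v ≟ v
  ... | yes _ = refl
  ... | no p  = Relation.Nullary.contradiction refl p
    where import Relation.Nullary

complement : ∀ {n} → Graph n → Graph n
complement G = record
  { adj        = λ u v → not (adj G u v) ∧ neq u v
  ; adj-sym    = λ u v → cong₂' (adj-sym G u v) (neq-sym u v)
  ; adj-irrefl = λ v → irr (not (adj G v v)) (neq-irrefl v)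
  }
  where
  cong₂' : ∀ {a b c d : Bool} → a ≡ b → c ≡ d → not a ∧ c ≡ not b ∧ d
  cong₂' refl refl = refl
  irr : ∀ (x : Bool) {y : Bool} → y ≡ false → x ∧ y ≡ false
  irr false refl = refl
  irr true  refl = refl

degIn : ∀ {n} → Graph n → List (Fin n) → Fin n → ℕ
degIn G S v = length (filter (λ u → T? (adj G v u)) S)

IsVertexSet : ∀ {n} → ℕ → List (Fin n) → Set
IsVertexSet j S = Unique S × length S ≡ j

SparseSet : ∀ {n} → Graph n → ℕ → ℕ → List (Fin n) → Set
SparseSet G k j S = IsVertexSet j S × All (λ v → degIn G S v ≤ k) S

DenseSet : ∀ {n} → Graph n → ℕ → ℕ → List (Fin n) → Set
DenseSet G k i S = SparseSet (complement G) k i S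

data Path {n} (G : Graph n) : List (Fin n) → Set where
  single : ∀ v → Path G (v ∷ [])
  step   : ∀ u v {vs} → T (adj G u v) → Path G (v ∷ vs) → Path G (u ∷ v ∷ vs)

IsCycle : ∀ {n} → Graph n → List (Fin n) → Set
IsCycle G [] = Data.Empty.⊥ where import Data.Empty
IsCycle G (v ∷ vs) =
  3 ≤ length (v ∷ vs) × Unique (v ∷ vs) × Path G (v ∷ vs ++ v ∷ [])

IsForest : ∀ {n} → Graph n → Set
IsForest G = ∀ C → ¬ IsCycle G C

RamseyProp : ℕ → ℕ → ℕ → ℕ → Set
RamseyProp k i j n = (G : Graph n) → IsForest G →
  (∃[ S ] DenseSet G k i S) Data.Sum.⊎ (∃[ S ] SparseSet G k j S)
  where import Data.Sum

RamseyForestEq : ℕ → ℕ → ℕ → ℕ → Set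
RamseyForestEq k i j N = RamseyProp k i j N × (∀ m → m < N → ¬ RamseyProp k i j m)

-- Peel the forest leaf by leaf (every vertex set of a forest contains a vertex with
-- at most one neighbour in it).  A kept leaf l is charged to its neighbour v: each vertex u carries
-- the number a u of kept neighbours already peeled off and the number t u ≥ a u of peeled vertices
-- it has absorbed.  A leaf with a l > k is deleted, paid for by the t l + 1 ≥ k + 2 vertices it
-- stands for; otherwise it is kept, and v absorbs it, or v is deleted if a l = k.  Every deletion
-- is paid for by k + 2 vertices, so an n-vertex forest has a k-sparse set of n − ⌊n/(k+2)⌋ vertices,
-- which is j when n = j + ⌊(j−1)/(k+1)⌋.  A leaf of a k-dense set S has at least |S| − 2
-- non-neighbours in S, so a forest has no k-dense (k+3)-set.
--
-- Lower bound.  On fewer vertices, the disjoint union of stars K₁,ₖ₊₁ has no k-sparse j-set: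
-- such a set misses a vertex of every full star.

module Submission where

open import Defs
open import Algebra.Properties.CommutativeSemigroup using (x∙yz≈y∙xz)
open import Data.Bool using (Bool; true; false; not; _∧_; _xor_; T)
open import Data.Bool.Properties using (xor-comm; xor-same; ∧-zeroʳ; T-∧; T-≡)
open import Data.Empty using (⊥; ⊥-elim)
open import Data.Fin using (Fin; toℕ; _≟_)
open import Data.Fin.Properties using (toℕ-injective; toℕ<n)
open import Data.List using (List; []; _∷_; _++_; length; filter; map; take; allFin; applyUpTo)
open import Data.Nat.ListAction using (sum)
open import Data.List.Membership.Propositional using (_∈_; _∉_; find)
open import Data.List.Membership.Propositional.Properties using (∈-filter⁻; ∈-filter⁺; ∈-∃++; ∈-applyUpTo⁺)
open import Data.List.Properties using (length-removeAt′; length-++; length-tabulate; length-take; length-applyUpTo; length-map; filter-accept; filter-reject; filter-none; filter-all; ++-assoc)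
open import Data.List.Relation.Binary.Subset.Propositional using (_⊆_)
open import Data.List.Relation.Unary.All as All using (All; []; _∷_)
open import Data.List.Relation.Unary.All.Properties using (─⁺; ++⁻ˡ; ¬Any⇒All¬; take⁺; map⁺)
open import Data.List.Relation.Unary.AllPairs using ([]; _∷_)
open import Data.List.Relation.Unary.Any using (here; there; index; _─_; any?)
open import Data.List.Relation.Unary.Unique.Propositional using (Unique)
import Data.List.Relation.Unary.Unique.Propositional.Properties as Unique
open import Data.Nat using (ℕ; zero; suc; _≡ᵇ_; _+_; _∸_; _*_; _≤_; _<_; z≤n; s≤s; _≤?_; _<?_; _/_; _%_)
open import Data.Nat.DivMod using (m≡m%n+[m/n]*n; m%n<n; m*n/n≡m; m/n*n≤m; m<n⇒m/n≡0; +-distrib-/-∣ʳ; /-monoˡ-≤)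
open import Data.Nat.Divisibility using (divides-refl)
open import Data.Nat.Tactic.RingSolver using (solve-∀)
open import Data.Nat.Induction using (<-wellFounded)
open import Data.Nat.Properties hiding (_≟_)
open import Data.Nat.Properties using () renaming (_≟_ to _≟ℕ_)
open import Data.Product using (_×_; _,_; ∃-syntax; proj₁; proj₂)
open import Data.Sum as Sum using (_⊎_; inj₁; inj₂; [_,_]′)
open import Function using (_∘_; Equivalence)
open import Induction.WellFounded using (Acc; acc)
open import Relation.Binary.PropositionalEquality
open import Relation.Nullary using (¬_; yes; no; contradiction)
open import Relation.Binary.Definitions using (tri<; tri≈; tri>)
open import Relation.Nullary.Decidable using (T?)

module _ {A : Set} where

  ∈-─⁻ : ∀ {xs : List A} {x y} (p : x ∈ xs) → y ∈ (xs ─ p) → y ∈ xs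
  ∈-─⁻ (here refl) q        = there q
  ∈-─⁻ (there p)   (here e)  = here e
  ∈-─⁻ (there p)   (there q) = there (∈-─⁻ p q)

  ∈-─⁺ : ∀ {xs : List A} {x y} (p : x ∈ xs) → y ∈ xs → y ≢ x → y ∈ (xs ─ p)
  ∈-─⁺ (here refl) (here refl) y≢x = ⊥-elim (y≢x refl)
  ∈-─⁺ (here refl) (there q)   _   = q
  ∈-─⁺ (there p)   (here e)    _   = here e
  ∈-─⁺ (there p)   (there q)   y≢x = there (∈-─⁺ p q y≢x)

  ∉-─ : ∀ {xs : List A} {x} (p : x ∈ xs) → Unique xs → x ∉ (xs ─ p)
  ∉-─ (here refl) (x∉ ∷ _) q         = All.lookup x∉ q refl
  ∉-─ (there p)   (y∉ ∷ _) (here refl) = All.lookup y∉ p refl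
  ∉-─ (there p)   (_ ∷ u)  (there q)   = ∉-─ p u q

  Unique-─ : ∀ {xs : List A} {x} (p : x ∈ xs) → Unique xs → Unique (xs ─ p)
  Unique-─ (here _)  (_ ∷ u)  = u
  Unique-─ (there p) (x∉ ∷ u) = ─⁺ p x∉ ∷ Unique-─ p u

  length-─ : ∀ {xs : List A} {x} (p : x ∈ xs) → length xs ≡ suc (length (xs ─ p))
  length-─ {xs} p = length-removeAt′ xs (index p)

  sum-map-─ : ∀ (f : A → ℕ) {xs x} (p : x ∈ xs) → sum (map f xs) ≡ f x + sum (map f (xs ─ p))
  sum-map-─ f (here refl)    = refl
  sum-map-─ f {y ∷ _} {x} (there p) =
    trans (cong (f y +_) (sum-map-─ f p)) (x∙yz≈y∙xz +-commutativeSemigroup (f y) (f x) _)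

  Unique⇒length-≤ : ∀ {xs ys : List A} → Unique xs → xs ⊆ ys → length xs ≤ length ys
  Unique⇒length-≤ {[]}     _          _     = z≤n
  Unique⇒length-≤ {x ∷ xs} {ys} (x∉ ∷ u) xs⊆ys = begin
    suc (length xs)        ≤⟨ s≤s (Unique⇒length-≤ u xs⊆ys─p) ⟩
    suc (length (ys ─ p))  ≡⟨ length-─ p ⟨
    length ys              ∎
    where
    open ≤-Reasoning
    p = xs⊆ys (here refl)
    xs⊆ys─p : xs ⊆ (ys ─ p)
    xs⊆ys─p y∈ = ∈-─⁺ p (xs⊆ys (there y∈)) λ { refl → All.lookup x∉ y∈ refl }

  Unique-++⁻ˡ : ∀ xs {ys : List A} → Unique (xs ++ ys) → Unique xs
  Unique-++⁻ˡ []       _        = []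
  Unique-++⁻ˡ (x ∷ xs) (x∉ ∷ u) = ++⁻ˡ xs x∉ ∷ Unique-++⁻ˡ xs u

  length≤1⇒∈-unique : ∀ {xs : List A} {x y} → length xs ≤ 1 → x ∈ xs → y ∈ xs → x ≡ y
  length≤1⇒∈-unique {_ ∷ []}    _           (here refl) (here refl) = refl
  length≤1⇒∈-unique {_ ∷ _ ∷ _} (s≤s ())    _           _

  take-⊆ : ∀ j {xs : List A} → take j xs ⊆ xs
  take-⊆ (suc j) {_ ∷ _} (here e)  = here e
  take-⊆ (suc j) {_ ∷ _} (there x∈) = there (take-⊆ j x∈)

Unique-interval-≤ : ∀ {ns : List ℕ} lo len → Unique ns → All (λ y → lo ≤ y × y < lo + len) ns → length ns ≤ len
Unique-interval-≤ {ns} lo len u inside =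
  subst (length ns ≤_) (length-applyUpTo (lo +_) len) (Unique⇒length-≤ u ns⊆)
  where
  ns⊆ : ns ⊆ applyUpTo (lo +_) len
  ns⊆ {y} y∈ with All.lookup inside y∈
  ... | lo≤y , y<lo+len = subst (_∈ applyUpTo (lo +_) len) (m+[n∸m]≡n lo≤y)
          (∈-applyUpTo⁺ (lo +_) (+-cancelˡ-< lo _ _ (subst (_< lo + len) (sym (m+[n∸m]≡n lo≤y)) y<lo+len)))

module _ {A : Set} (f : A → ℕ) where

  count-below : ℕ → List A → ℕ
  count-below b xs = length (filter (λ x → f x <? b) xs)

  count-at : ℕ → List A → ℕ
  count-at b xs = length (filter (λ x → f x ≟ℕ b) xs)

  private
    below-∷ : ∀ {b x} xs → f x < b → count-below b (x ∷ xs) ≡ suc (count-below b xs)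
    below-∷ {b} _ = cong length ∘ filter-accept (λ y → f y <? b)
    not-below-∷ : ∀ {b x} xs → ¬ f x < b → count-below b (x ∷ xs) ≡ count-below b xs
    not-below-∷ {b} _ = cong length ∘ filter-reject (λ y → f y <? b)
    at-∷ : ∀ {b x} xs → f x ≡ b → count-at b (x ∷ xs) ≡ suc (count-at b xs)
    at-∷ {b} _ = cong length ∘ filter-accept (λ y → f y ≟ℕ b)
    not-at-∷ : ∀ {b x} xs → f x ≢ b → count-at b (x ∷ xs) ≡ count-at b xs
    not-at-∷ {b} _ = cong length ∘ filter-reject (λ y → f y ≟ℕ b)

  count-below-suc : ∀ b xs → count-below (suc b) xs ≡ count-below b xs + count-at b xs
  count-below-suc b []       = refl
  count-below-suc b (x ∷ xs) with <-cmp (f x) b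
  ... | tri< fx<b fx≢b _ = begin
    count-below (suc b) (x ∷ xs)               ≡⟨ below-∷ xs (m<n⇒m<1+n fx<b) ⟩
    suc (count-below (suc b) xs)               ≡⟨ cong suc (count-below-suc b xs) ⟩
    suc (count-below b xs) + count-at b xs     ≡⟨ cong₂ _+_ (below-∷ xs fx<b) (not-at-∷ xs fx≢b) ⟨
    count-below b (x ∷ xs) + count-at b (x ∷ xs) ∎
    where open ≡-Reasoning
  ... | tri≈ fx≮b fx≡b _ = begin
    count-below (suc b) (x ∷ xs)               ≡⟨ below-∷ xs (≤-reflexive (cong suc fx≡b)) ⟩
    suc (count-below (suc b) xs)               ≡⟨ cong suc (count-below-suc b xs) ⟩
    suc (count-below b xs + count-at b xs)     ≡⟨ +-suc _ _ ⟨
    count-below b xs + suc (count-at b xs)     ≡⟨ cong₂ _+_ (not-below-∷ xs fx≮b) (at-∷ xs fx≡b) ⟨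
    count-below b (x ∷ xs) + count-at b (x ∷ xs) ∎
    where open ≡-Reasoning
  ... | tri> fx≮b fx≢b b<fx = begin
    count-below (suc b) (x ∷ xs)               ≡⟨ not-below-∷ xs (<⇒≱ b<fx ∘ ≤-pred) ⟩
    count-below (suc b) xs                     ≡⟨ count-below-suc b xs ⟩
    count-below b xs + count-at b xs           ≡⟨ cong₂ _+_ (not-below-∷ xs fx≮b) (not-at-∷ xs fx≢b) ⟨
    count-below b (x ∷ xs) + count-at b (x ∷ xs) ∎
    where open ≡-Reasoning

  count-below-≤ : ∀ {s} b xs → (∀ c → c < b → count-at c xs ≤ s) → count-below b xs ≤ b * s
  count-below-≤ zero    xs _      = ≤-reflexive (cong length (filter-none (λ x → f x <? 0) {xs} (All.tabulate (λ _ ()))))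
  count-below-≤ {s} (suc b) xs bounded = begin
    count-below (suc b) xs           ≡⟨ count-below-suc b xs ⟩
    count-below b xs + count-at b xs ≤⟨ +-mono-≤ (count-below-≤ b xs (λ c c<b → bounded c (m<n⇒m<1+n c<b))) (bounded b ≤-refl) ⟩
    b * s + s                        ≡⟨ +-comm (b * s) s ⟩
    suc b * s                        ∎
    where open ≤-Reasoning

  count-below-all : ∀ {b} xs → All (λ x → f x < b) xs → count-below b xs ≡ length xs
  count-below-all {b} xs below = cong length (filter-all (λ x → f x <? b) below)

module _ {n : ℕ} (G : Graph n) where

  Adj : Fin n → Fin n → Set
  Adj u v = T (adj G u v)

  Adj-sym : ∀ {u v} → Adj u v → Adj v u
  Adj-sym {u} {v} = subst T (adj-sym G u v)

  Adj-irrefl : ∀ {u v} → Adj u v → u ≢ v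
  Adj-irrefl {u} a refl = subst T (adj-irrefl G u) a

  degIn-∷-adj : ∀ {v x} xs → Adj v x → degIn G (x ∷ xs) v ≡ suc (degIn G xs v)
  degIn-∷-adj {v} _ a = cong length (filter-accept (T? ∘ adj G v) a)

  degIn-∷-nonadj : ∀ {v x} xs → ¬ Adj v x → degIn G (x ∷ xs) v ≡ degIn G xs v
  degIn-∷-nonadj {v} _ ¬a = cong length (filter-reject (T? ∘ adj G v) ¬a)

  degIn-none : ∀ {v xs} → All (¬_ ∘ Adj v) xs → degIn G xs v ≡ 0
  degIn-none {v} none = cong length (filter-none (T? ∘ adj G v) none)

  ∈-neighbours : ∀ {v x xs} → x ∈ xs → Adj v x → x ∈ filter (T? ∘ adj G v) xs
  ∈-neighbours {v} = ∈-filter⁺ (T? ∘ adj G v)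

  degIn-mono : ∀ {v K L} → Unique K → K ⊆ L → degIn G K v ≤ degIn G L v
  degIn-mono {v} {K} uK K⊆L = Unique⇒length-≤ (Unique.filter⁺ (T? ∘ adj G v) uK) λ x∈ →
    let x∈K , a = ∈-filter⁻ (T? ∘ adj G v) {xs = K} x∈ in ∈-neighbours (K⊆L x∈K) a

  degIn≤1⇒neighbour-unique : ∀ {v xs x y} → degIn G xs v ≤ 1 →
    x ∈ xs → Adj v x → y ∈ xs → Adj v y → x ≡ y
  degIn≤1⇒neighbour-unique deg x∈ ax y∈ ay =
    length≤1⇒∈-unique deg (∈-neighbours x∈ ax) (∈-neighbours y∈ ay)

  degIn-─-self : ∀ {v xs} (p : v ∈ xs) → degIn G (xs ─ p) v ≡ degIn G xs v
  degIn-─-self {v} {_ ∷ xs} (here refl) = sym (degIn-∷-nonadj xs (λ a → Adj-irrefl a refl))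
  degIn-─-self {v} {y ∷ _}  (there p) with adj G v y
  ... | true  = cong suc (degIn-─-self p)
  ... | false = degIn-─-self p

  degIn+degInᶜ : ∀ v xs → v ∉ xs → degIn G xs v + degIn (complement G) xs v ≡ length xs
  degIn+degInᶜ v []       _  = refl
  degIn+degInᶜ v (x ∷ xs) v∉ with adj G v x | v ≟ x | degIn+degInᶜ v xs (v∉ ∘ there)
  ... | _     | yes refl | _  = ⊥-elim (v∉ (here refl))
  ... | true  | no _     | ih = cong suc ih
  ... | false | no _     | ih = trans (+-suc _ _) (cong suc ih)

-- Leaves of forests

module _ {n : ℕ} (G : Graph n) where

  ∃≢-neighbour : ∀ {v xs} → Unique xs → 2 ≤ degIn G xs v → ∀ p → ∃[ x ] (x ∈ xs × Adj G v x × x ≢ p)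
  ∃≢-neighbour {v} {xs} u deg p = pick (Unique.filter⁺ (T? ∘ adj G v) u) deg (λ x∈ → x∈)
    where
    neighbour : ∀ {x} → x ∈ filter (T? ∘ adj G v) xs → x ∈ xs × Adj G v x
    neighbour = ∈-filter⁻ (T? ∘ adj G v)
    pick : ∀ {ys} → Unique ys → 2 ≤ length ys → ys ⊆ filter (T? ∘ adj G v) xs → ∃[ x ] (x ∈ xs × Adj G v x × x ≢ p)
    pick {_ ∷ []}    _               (s≤s ()) _
    pick {a ∷ b ∷ _} ((a≢b ∷ _) ∷ _) _        ys⊆ with a ≟ p
    ... | yes refl = let b∈ , vb = neighbour (ys⊆ (there (here refl))) in b , b∈ , vb , a≢b ∘ sym
    ... | no a≢p   = let a∈ , va = neighbour (ys⊆ (here refl)) in a , a∈ , va , a≢p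

  Path-prefix-edge : ∀ as {x zs w} → Path G (as ++ x ∷ zs) → Adj G x w → Path G (as ++ x ∷ w ∷ [])
  Path-prefix-edge []           {zs = []}    (single _)     a = step _ _ a (single _)
  Path-prefix-edge []           {zs = _ ∷ _} (step _ _ _ _) a = step _ _ a (single _)
  Path-prefix-edge (_ ∷ [])     (step _ _ e p) a = step _ _ e (Path-prefix-edge [] p a)
  Path-prefix-edge (_ ∷ b ∷ as) (step _ _ e p) a = step _ _ e (Path-prefix-edge (b ∷ as) p a)

  chord⇒cycle : ∀ {u p rest x} → Unique (u ∷ p ∷ rest) → Path G (u ∷ p ∷ rest) →
    x ∈ rest → Adj G x u → ∃[ C ] IsCycle G C
  chord⇒cycle {u} {p} {x = x} uniq path x∈ xu with ∈-∃++ x∈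
  ... | ys , zs , refl = C , length≥3 , Unique-++⁻ˡ C uniq′ , path′
    where
    C = u ∷ p ∷ ys ++ x ∷ []
    length≥3 : 3 ≤ length C
    length≥3 = s≤s (s≤s (subst (1 ≤_) (sym (length-++ ys)) (m≤n+m 1 (length ys))))
    uniq′ : Unique (C ++ zs)
    uniq′ = subst (Unique ∘ (λ l → u ∷ p ∷ l)) (sym (++-assoc ys (x ∷ []) zs)) uniq
    path′ : Path G (C ++ u ∷ [])
    path′ = subst (Path G ∘ (λ l → u ∷ p ∷ l)) (sym (++-assoc ys (x ∷ []) (u ∷ [])))
              (Path-prefix-edge (u ∷ p ∷ ys) path xu)

module _ {n : ℕ} {G : Graph n} (forest : IsForest G) where
  open import Data.List.Membership.DecPropositional (_≟_ {n}) using (_∈?_)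

  min-degree≥2⇒¬forest : ∀ {W} → Unique W → All (λ u → 2 ≤ degIn G W u) W → ∀ {w} → w ∈ W → ⊥
  min-degree≥2⇒¬forest {W} uW deg2 {w} w∈ with ∃≢-neighbour G uW (All.lookup deg2 w∈) w
  ... | x , x∈ , wx , _ = grow (length W) (s≤s (m≤n+m (length W) 1))
                            ((Adj-irrefl G (Adj-sym G wx) ∷ []) ∷ [] ∷ [])
                            (λ { (here refl) → x∈ ; (there (here refl)) → w∈ })
                            (step _ _ (Adj-sym G wx) (single _))
    where
    grow : ∀ fuel {u p rest} → length W < length (u ∷ p ∷ rest) + fuel →
      Unique (u ∷ p ∷ rest) → (u ∷ p ∷ rest) ⊆ W → Path G (u ∷ p ∷ rest) → ⊥
    grow zero       long uniq ⊆W _ =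
      <⇒≱ (subst (length W <_) (+-identityʳ _) long) (Unique⇒length-≤ uniq ⊆W)
    grow (suc fuel) {u} {p} {rest} long uniq ⊆W path
      with ∃≢-neighbour G uW (All.lookup deg2 (⊆W (here refl))) p
    ... | y , y∈ , uy , y≢p with y ∈? (u ∷ p ∷ rest)
    ...   | yes (here refl)         = Adj-irrefl G uy refl
    ...   | yes (there (here refl)) = y≢p refl
    ...   | yes (there (there y∈r)) = let C , cyc = chord⇒cycle G uniq path y∈r (Adj-sym G uy) in forest C cyc
    ...   | no y∉ = grow fuel (subst (length W <_) (+-suc _ fuel) long)
                      (¬Any⇒All¬ _ y∉ ∷ uniq)
                      (λ { (here refl) → y∈ ; (there z∈) → ⊆W z∈ })
                      (step _ _ (Adj-sym G uy) path)

  forest-leaf : ∀ {w ws} → Unique (w ∷ ws) → ∃[ l ] (l ∈ w ∷ ws × degIn G (w ∷ ws) l ≤ 1)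
  forest-leaf {w} {ws} uW with any? (λ l → degIn G (w ∷ ws) l ≤? 1) (w ∷ ws)
  ... | yes leaf = find leaf
  ... | no ¬leaf = ⊥-elim (min-degree≥2⇒¬forest uW (All.map ≰⇒> (¬Any⇒All¬ _ ¬leaf)) (here refl))

length≡1+degIn+degInᶜ : ∀ {n} (G : Graph n) {v xs} → Unique xs → v ∈ xs →
  length xs ≡ suc (degIn G xs v + degIn (complement G) xs v)
length≡1+degIn+degInᶜ G {v} {xs} u p = begin
  length xs                                                 ≡⟨ length-─ p ⟩
  suc (length (xs ─ p))                                     ≡⟨ cong suc (degIn+degInᶜ G v (xs ─ p) (∉-─ p u)) ⟨
  suc (degIn G (xs ─ p) v + degIn (complement G) (xs ─ p) v) ≡⟨ cong suc (cong₂ _+_ (degIn-─-self G p) (degIn-─-self (complement G) p)) ⟩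
  suc (degIn G xs v + degIn (complement G) xs v)            ∎
  where open ≡-Reasoning

forest-dense-set-≤ : ∀ {n} {G : Graph n} {k i S} → IsForest G → DenseSet G k i S → i ≤ suc (suc k)
forest-dense-set-≤ {S = []}    _      ((_ , refl) , _)         = z≤n
forest-dense-set-≤ {G = G} {k} {S = w ∷ ws} forest ((uS , refl) , dense) with forest-leaf forest uS
... | l , l∈ , leaf = begin
  length (w ∷ ws)                                            ≡⟨ length≡1+degIn+degInᶜ G uS l∈ ⟩
  suc (degIn G (w ∷ ws) l + degIn (complement G) (w ∷ ws) l) ≤⟨ s≤s (+-mono-≤ leaf (All.lookup dense l∈)) ⟩
  suc (suc k)                                                ∎
  where open ≤-Reasoning

-- Stripping leaves

module _ {n : ℕ} where

  addAt : (Fin n → ℕ) → Fin n → ℕ → Fin n → ℕ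
  addAt f v c u with u ≟ v
  ... | yes _ = c + f u
  ... | no _  = f u

  addAt-≡ : ∀ f v c → addAt f v c v ≡ c + f v
  addAt-≡ f v c with v ≟ v
  ... | yes _   = refl
  ... | no v≢v = ⊥-elim (v≢v refl)

  addAt-≢ : ∀ f {v} c {u} → u ≢ v → addAt f v c u ≡ f u
  addAt-≢ f {v} c {u} u≢v with u ≟ v
  ... | yes u≡v = ⊥-elim (u≢v u≡v)
  ... | no _    = refl

  addAt-mono : ∀ {f g : Fin n → ℕ} {v c d u} → f u ≤ g u → c ≤ d → addAt f v c u ≤ addAt g v d u
  addAt-mono {v = v} {u = u} f≤g c≤d with u ≟ v
  ... | yes _ = +-mono-≤ c≤d f≤g
  ... | no _  = f≤g

  total : (Fin n → ℕ) → List (Fin n) → ℕ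
  total t W = sum (map t W)

  total-addAt-∉ : ∀ t {v} c {W} → v ∉ W → total (addAt t v c) W ≡ total t W
  total-addAt-∉ t c {[]}    _  = refl
  total-addAt-∉ t c {_ ∷ _} v∉ =
    cong₂ _+_ (addAt-≢ t c (λ { refl → v∉ (here refl) })) (total-addAt-∉ t c (v∉ ∘ there))

  total-addAt : ∀ t {v} c {W} → Unique W → v ∈ W → total (addAt t v c) W ≡ c + total t W
  total-addAt t {v} c (v∉ ∷ _) (here refl) =
    trans (cong₂ _+_ (addAt-≡ t v c) (total-addAt-∉ t c (λ v∈ → All.lookup v∉ v∈ refl)))
          (+-assoc c (t v) _)
  total-addAt t {v} c {x ∷ _} (x∉ ∷ u) (there p) =
    trans (cong₂ _+_ (addAt-≢ t c (All.lookup x∉ p)) (total-addAt t c u p))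
          (x∙yz≈y∙xz +-commutativeSemigroup (t x) c _)

  total-zero : ∀ W → total (λ _ → 0) W ≡ 0
  total-zero []      = refl
  total-zero (_ ∷ W) = total-zero W

  length+total-─ : ∀ t {W x} (p : x ∈ W) →
    length W + total t W ≡ suc (t x) + (length (W ─ p) + total t (W ─ p))
  length+total-─ t {W} {x} p = begin
    length W + total t W                                ≡⟨ cong₂ _+_ (length-─ p) (sum-map-─ t p) ⟩
    suc (length (W ─ p)) + (t x + total t (W ─ p))      ≡⟨ cong suc (x∙yz≈y∙xz +-commutativeSemigroup (length (W ─ p)) (t x) _) ⟩
    suc (t x) + (length (W ─ p) + total t (W ─ p))      ∎
    where open ≡-Reasoning

module _ {n : ℕ} (G : Graph n) (k : ℕ) where

  record Stripped (a t : Fin n → ℕ) (W : List (Fin n)) : Set where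
    field
      kept        : List (Fin n)
      deleted     : ℕ
      kept-unique : Unique kept
      kept⊆W      : kept ⊆ W
      kept-sparse : All (λ u → degIn G kept u + a u ≤ k) kept
      size        : length kept + deleted ≡ length W
      cost        : suc (suc k) * deleted ≤ length W + total t W

  private
    cost-delete : ∀ {c X D} → suc (suc k) ≤ c → suc (suc k) * D ≤ X → suc (suc k) * suc D ≤ c + X
    cost-delete {c} {X} {D} k+2≤c ih = subst (_≤ c + X) (sym (*-suc (suc (suc k)) D)) (+-mono-≤ k+2≤c ih)

    keep : ∀ {a t : Fin n → ℕ} {W l K D} (p : l ∈ W) → Unique W → Unique K → K ⊆ (W ─ p) →
      All (λ u → degIn G (l ∷ K) u + a u ≤ k) (l ∷ K) → suc (length K) + D ≡ length W →
      suc (suc k) * D ≤ length W + total t W → Stripped a t W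
    keep p uW uK K⊆ sparse size cost = record
      { kept        = _ ∷ _
      ; deleted     = _
      ; kept-unique = ¬Any⇒All¬ _ (∉-─ p uW ∘ K⊆) ∷ uK
      ; kept⊆W      = λ { (here refl) → p ; (there u∈) → ∈-─⁻ p (K⊆ u∈) }
      ; kept-sparse = sparse
      ; size        = size
      ; cost        = cost
      }

    sparse-∷-nonadj : ∀ {a : Fin n → ℕ} {l K} → a l ≤ k → All (¬_ ∘ Adj G l) K →
      All (λ u → degIn G K u + a u ≤ k) K → All (λ u → degIn G (l ∷ K) u + a u ≤ k) (l ∷ K)
    sparse-∷-nonadj {a} {l} {K} al≤k nonadj sparse = l-sparse ∷ All.zipWith K-sparse (nonadj , sparse)
      where
      l-sparse : degIn G (l ∷ K) l + a l ≤ k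
      l-sparse = subst (λ d → d + a l ≤ k)
        (sym (trans (degIn-∷-nonadj G K (λ ll → Adj-irrefl G ll refl)) (degIn-none G nonadj))) al≤k
      K-sparse : ∀ {u} → (¬ Adj G l u) × (degIn G K u + a u ≤ k) → degIn G (l ∷ K) u + a u ≤ k
      K-sparse {u} (¬lu , u-sparse) = subst (λ d → d + a u ≤ k) (sym (degIn-∷-nonadj G K (¬lu ∘ Adj-sym G))) u-sparse

  delete-leaf : ∀ {a t W l} (p : l ∈ W) → k < t l → Stripped a t (W ─ p) → Stripped a t W
  delete-leaf {t = t} p k<tl R = record
    { kept        = kept
    ; deleted     = suc deleted
    ; kept-unique = kept-unique
    ; kept⊆W      = ∈-─⁻ p ∘ kept⊆W
    ; kept-sparse = kept-sparse
    ; size        = trans (+-suc _ _) (trans (cong suc size) (sym (length-─ p)))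
    ; cost        = subst (suc (suc k) * suc deleted ≤_) (sym (length+total-─ t p)) (cost-delete (s≤s k<tl) cost)
    }
    where open Stripped R

  keep-isolated-leaf : ∀ {a t W l} (p : l ∈ W) → Unique W → a l ≤ k → All (¬_ ∘ Adj G l) (W ─ p) →
    Stripped a t (W ─ p) → Stripped a t W
  keep-isolated-leaf {t = t} {W} {l} p uW al≤k isolated R =
    keep p uW kept-unique kept⊆W
      (sparse-∷-nonadj al≤k (All.tabulate (All.lookup isolated ∘ kept⊆W)) kept-sparse)
      (trans (cong suc size) (sym (length-─ p)))
      (≤-trans cost (subst (length (W ─ p) + total t (W ─ p) ≤_) (sym (length+total-─ t p)) (m≤n+m _ (suc (t l)))))
    where open Stripped R

  keep-leaf-delete-neighbour : ∀ {a t W l v} (p : l ∈ W) (q : v ∈ (W ─ p)) → Unique W →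
    degIn G W l ≤ 1 → Adj G l v → a l ≤ k → k ≤ t l →
    Stripped a t (W ─ p ─ q) → Stripped a t W
  keep-leaf-delete-neighbour {t = t} {W} {l} {v} p q uW leaf lv al≤k k≤tl R =
    keep p uW kept-unique (∈-─⁻ q ∘ kept⊆W)
      (sparse-∷-nonadj al≤k (All.tabulate nonadj) kept-sparse)
      (trans (cong suc (trans (+-suc _ _) (cong suc size))) (trans (cong suc (sym (length-─ q))) (sym (length-─ p))))
      (subst (suc (suc k) * suc deleted ≤_) (sym total-eq) (cost-delete k+2≤ cost))
    where
    open Stripped R
    nonadj : ∀ {u} → u ∈ kept → ¬ Adj G l u
    nonadj u∈ lu with degIn≤1⇒neighbour-unique G leaf (∈-─⁻ p (∈-─⁻ q (kept⊆W u∈))) lu (∈-─⁻ p q) lv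
    ... | refl = ∉-─ q (Unique-─ p uW) (kept⊆W u∈)
    k+2≤ : suc (suc k) ≤ suc (t l) + suc (t v)
    k+2≤ = s≤s (subst (suc k ≤_) (sym (+-suc (t l) (t v)))
                  (s≤s (≤-trans k≤tl (m≤m+n (t l) (t v)))))
    total-eq : length W + total t W ≡ (suc (t l) + suc (t v)) + (length (W ─ p ─ q) + total t (W ─ p ─ q))
    total-eq = begin
      length W + total t W                                              ≡⟨ length+total-─ t p ⟩
      suc (t l) + (length (W ─ p) + total t (W ─ p))                     ≡⟨ cong (suc (t l) +_) (length+total-─ t q) ⟩
      suc (t l) + (suc (t v) + (length (W ─ p ─ q) + total t (W ─ p ─ q))) ≡⟨ +-assoc (suc (t l)) _ _ ⟨
      (suc (t l) + suc (t v)) + (length (W ─ p ─ q) + total t (W ─ p ─ q)) ∎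
      where open ≡-Reasoning

  keep-leaf-absorbed-by-neighbour : ∀ {a t W l v} (p : l ∈ W) (q : v ∈ (W ─ p)) → Unique W →
    degIn G W l ≤ 1 → Adj G l v → a l < k →
    Stripped (addAt a v 1) (addAt t v (suc (t l))) (W ─ p) → Stripped a t W
  keep-leaf-absorbed-by-neighbour {a} {t} {W} {l} {v} p q uW leaf lv al<k R =
    keep p uW kept-unique kept⊆W (l-sparse ∷ All.tabulate K-sparse)
      (trans (cong suc size) (sym (length-─ p)))
      (subst (suc (suc k) * deleted ≤_) total-eq cost)
    where
    open Stripped R
    l-sparse : degIn G (l ∷ kept) l + a l ≤ k
    l-sparse = begin
      degIn G (l ∷ kept) l + a l ≡⟨ cong (_+ a l) (degIn-∷-nonadj G kept (λ ll → Adj-irrefl G ll refl)) ⟩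
      degIn G kept l + a l       ≤⟨ +-monoˡ-≤ (a l) (≤-trans (degIn-mono G kept-unique (∈-─⁻ p ∘ kept⊆W)) leaf) ⟩
      suc (a l)                  ≤⟨ al<k ⟩
      k                          ∎
      where open ≤-Reasoning
    K-sparse : ∀ {u} → u ∈ kept → degIn G (l ∷ kept) u + a u ≤ k
    K-sparse {u} u∈ with u ≟ v | All.lookup kept-sparse u∈
    ... | yes refl | u-sparse = begin
      degIn G (l ∷ kept) u + a u    ≡⟨ cong (_+ a u) (degIn-∷-adj G kept (Adj-sym G lv)) ⟩
      suc (degIn G kept u) + a u    ≡⟨ +-suc _ (a u) ⟨
      degIn G kept u + suc (a u)    ≤⟨ u-sparse ⟩
      k                             ∎
      where open ≤-Reasoning
    ... | no u≢v | u-sparse = subst (_≤ k)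
          (cong (_+ a u) (sym (degIn-∷-nonadj G kept (nonadj ∘ Adj-sym G)))) u-sparse
      where
      nonadj : ¬ Adj G l u
      nonadj lu = u≢v (degIn≤1⇒neighbour-unique G leaf (∈-─⁻ p (kept⊆W u∈)) lu (∈-─⁻ p q) lv)
    total-eq : length (W ─ p) + total (addAt t v (suc (t l))) (W ─ p) ≡ length W + total t W
    total-eq = begin
      length (W ─ p) + total (addAt t v (suc (t l))) (W ─ p) ≡⟨ cong (length (W ─ p) +_) (total-addAt t _ (Unique-─ p uW) q) ⟩
      length (W ─ p) + (suc (t l) + total t (W ─ p))        ≡⟨ x∙yz≈y∙xz +-commutativeSemigroup (length (W ─ p)) (suc (t l)) _ ⟩
      suc (t l) + (length (W ─ p) + total t (W ─ p))        ≡⟨ length+total-─ t p ⟨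
      length W + total t W                                  ∎
      where open ≡-Reasoning

module _ {n : ℕ} {G : Graph n} (forest : IsForest G) (k : ℕ) where

  strip : ∀ {W} → Acc _<_ (length W) → Unique W → ∀ a t → All (λ u → a u ≤ t u) W → Stripped G k a t W
  strip {[]} _ _ _ _ _ = record
    { kept = [] ; deleted = 0 ; kept-unique = [] ; kept⊆W = λ () ; kept-sparse = []
    ; size = refl ; cost = ≤-reflexive (*-zeroʳ (suc (suc k))) }
  strip {W@(_ ∷ _)} (acc smaller) uW a t a≤t = strip-at (forest-leaf forest uW)
    where
    strip-─ : ∀ {V x} (p : x ∈ V) → length V ≤ length W → Unique V → ∀ a t →
      All (λ u → a u ≤ t u) (V ─ p) → Stripped G k a t (V ─ p)
    strip-─ p V≤W uV = strip (smaller (≤-trans (≤-reflexive (sym (length-─ p))) V≤W)) (Unique-─ p uV)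
    strip-at : ∃[ l ] (l ∈ W × degIn G W l ≤ 1) → Stripped G k a t W
    strip-at (l , p , leaf) with a l ≤? k
    ... | no al≰k = delete-leaf G k p (<-≤-trans (≰⇒> al≰k) (All.lookup a≤t p)) (strip-─ p ≤-refl uW a t (─⁺ p a≤t))
    ... | yes al≤k with any? (T? ∘ adj G l) (W ─ p)
    ...   | no none = keep-isolated-leaf G k p uW al≤k (¬Any⇒All¬ _ none) (strip-─ p ≤-refl uW a t (─⁺ p a≤t))
    ...   | yes some with find some | m≤n⇒m<n∨m≡n al≤k
    ...     | v , q , lv | inj₁ al<k = keep-leaf-absorbed-by-neighbour G k p q uW leaf lv al<k
                (strip-─ p ≤-refl uW (addAt a v 1) (addAt t v (suc (t l))) (All.map absorb (─⁺ p a≤t)))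
      where
      absorb : ∀ {u} → a u ≤ t u → addAt a v 1 u ≤ addAt t v (suc (t l)) u
      absorb {u} au≤tu = addAt-mono {f = a} {g = t} {u = u} au≤tu (s≤s z≤n)
    ...     | v , q , lv | inj₂ al≡k = keep-leaf-delete-neighbour G k p q uW leaf lv al≤k (subst (_≤ t l) al≡k (All.lookup a≤t p))
                (strip-─ q (≤-trans (n≤1+n _) (≤-reflexive (sym (length-─ p)))) (Unique-─ p uW) a t (─⁺ q (─⁺ p a≤t)))

forest-sparse-set : ∀ {n} {G : Graph n} → IsForest G → ∀ k →
  ∃[ K ] (Unique K × All (λ u → degIn G K u ≤ k) K × n ≤ length K + n / suc (suc k))
forest-sparse-set {n} {G} forest k = kept , kept-unique , All.map (subst (_≤ k) (+-identityʳ _)) kept-sparse , n≤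
  where
  open Stripped (strip forest k (<-wellFounded _) (Unique.allFin⁺ n) (λ _ → 0) (λ _ → 0) (All.tabulate (λ _ → z≤n)))
  length-allFin : length (allFin n) ≡ n
  length-allFin = length-tabulate (λ i → i)
  deleted≤ : deleted ≤ n / suc (suc k)
  deleted≤ = subst (_≤ n / suc (suc k)) (m*n/n≡m deleted (suc (suc k)))
    (/-monoˡ-≤ (suc (suc k)) (subst₂ _≤_ (*-comm (suc (suc k)) deleted)
      (trans (cong₂ _+_ length-allFin (total-zero (allFin n))) (+-identityʳ n)) cost))
  n≤ : n ≤ length kept + n / suc (suc k)
  n≤ = subst (_≤ length kept + n / suc (suc k)) (trans size length-allFin) (+-monoʳ-≤ (length kept) deleted≤)

sparse-set-take : ∀ {n} {G : Graph n} {k K} j → Unique K → All (λ u → degIn G K u ≤ k) K →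
  j ≤ length K → SparseSet G k j (take j K)
sparse-set-take {G = G} j uK sparse j≤ =
  (Unique.take⁺ j uK , trans (length-take j _) (m≤n⇒m⊓n≡m j≤)) ,
  All.map (≤-trans (degIn-mono G (Unique.take⁺ j uK) (take-⊆ j))) (take⁺ j sparse)

-- Star forests

≡ᵇ-sym : ∀ m n → (m ≡ᵇ n) ≡ (n ≡ᵇ m)
≡ᵇ-sym zero    zero    = refl
≡ᵇ-sym zero    (suc _) = refl
≡ᵇ-sym (suc _) zero    = refl
≡ᵇ-sym (suc m) (suc n) = ≡ᵇ-sym m n

T-xor⇒≡not : ∀ a b → T (a xor b) → a ≡ not b
T-xor⇒≡not true  false _ = refl
T-xor⇒≡not false true  _ = refl

alternating : ∀ {a b c d} → a ≡ not b → b ≡ not c → c ≡ not d → (T a × T c) ⊎ (T b × T d)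
alternating {b = false} {c = true}              refl refl _    = inj₁ _
alternating {b = true}  {c = false} {d = true}  _    refl refl = inj₂ _
alternating {b = false} {c = false}             _    ()   _
alternating {b = true}  {c = true}              _    ()   _
alternating {b = true}  {c = false} {d = false} _    refl ()

short-walks-revisit⇒forest : ∀ {n} (G : Graph n) →
  (∀ {w₀ w₁ w₂ w₃} → Adj G w₀ w₁ → Adj G w₁ w₂ → Adj G w₂ w₃ → w₀ ≡ w₂ ⊎ w₁ ≡ w₃) → IsForest G
short-walks-revisit⇒forest G revisit (_ ∷ [])     (s≤s () , _)
short-walks-revisit⇒forest G revisit (_ ∷ _ ∷ []) (s≤s (s≤s ()) , _)
short-walks-revisit⇒forest G revisit (_ ∷ _ ∷ _ ∷ [])
  (_ , ((v≢a ∷ v≢b ∷ []) ∷ _) , step _ _ va (step _ _ ab (step _ _ bv _))) =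
  [ v≢b , v≢a ∘ sym ]′ (revisit va ab bv)
short-walks-revisit⇒forest G revisit (_ ∷ _ ∷ _ ∷ _ ∷ _)
  (_ , ((_ ∷ v≢b ∷ _) ∷ (_ ∷ a≢c ∷ _) ∷ _) , step _ _ va (step _ _ ab (step _ _ bc _))) =
  [ v≢b , a≢c ]′ (revisit va ab bc)

-- The disjoint union of the stars K₁,ₖ₊₁ on the blocks of k + 2 consecutive vertices, each centred
-- at the multiple of k + 2 starting its block (the last block may be an incomplete star).
module StarForest (k m : ℕ) where

  block : Fin m → ℕ
  block x = toℕ x / suc (suc k)

  centre : Fin m → Bool
  centre x = toℕ x % suc (suc k) ≡ᵇ 0

  starForest : Graph m
  starForest = record
    { adj        = λ x y → (block x ≡ᵇ block y) ∧ (centre x xor centre y)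
    ; adj-sym    = λ x y → cong₂ _∧_ (≡ᵇ-sym (block x) (block y)) (xor-comm (centre x) (centre y))
    ; adj-irrefl = λ x → trans (cong ((block x ≡ᵇ block x) ∧_) (xor-same (centre x))) (∧-zeroʳ _)
    }

  toℕ≡%+block* : ∀ x → toℕ x ≡ toℕ x % suc (suc k) + block x * suc (suc k)
  toℕ≡%+block* x = m≡m%n+[m/n]*n (toℕ x) (suc (suc k))

  centre-unique : ∀ {x y} → T (centre x) → T (centre y) → block x ≡ block y → x ≡ y
  centre-unique {x} {y} cx cy bxy = toℕ-injective (begin
    toℕ x                                        ≡⟨ toℕ≡%+block* x ⟩
    toℕ x % suc (suc k) + block x * suc (suc k)  ≡⟨ cong₂ (λ r b → r + b * suc (suc k)) (trans (≡ᵇ⇒≡ _ 0 cx) (sym (≡ᵇ⇒≡ _ 0 cy))) bxy ⟩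
    toℕ y % suc (suc k) + block y * suc (suc k)  ≡⟨ toℕ≡%+block* y ⟨
    toℕ y                                        ∎)
    where open ≡-Reasoning

  edge-block : ∀ {x y} → Adj starForest x y → block x ≡ block y
  edge-block {x} {y} = ≡ᵇ⇒≡ (block x) (block y) ∘ proj₁ ∘ Equivalence.to T-∧

  edge-centre : ∀ {x y} → Adj starForest x y → centre x ≡ not (centre y)
  edge-centre {x} {y} = T-xor⇒≡not (centre x) (centre y) ∘ proj₂ ∘ Equivalence.to T-∧

  centre-adj : ∀ {c x} → T (centre c) → block c ≡ block x → x ≢ c → Adj starForest c x
  centre-adj {c} {x} cc bcx x≢c with centre x in cx
  ... | true  = ⊥-elim (x≢c (centre-unique (subst T (sym cx) _) cc (sym bcx)))
  ... | false = Equivalence.from T-∧ (≡⇒≡ᵇ (block c) (block x) bcx , subst (λ b → T (b xor false)) (sym (Equivalence.to T-≡ cc)) _)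

  starForest-isForest : IsForest starForest
  starForest-isForest = short-walks-revisit⇒forest starForest revisit
    where
    revisit : ∀ {w₀ w₁ w₂ w₃} → Adj starForest w₀ w₁ → Adj starForest w₁ w₂ → Adj starForest w₂ w₃ →
      w₀ ≡ w₂ ⊎ w₁ ≡ w₃
    revisit {w₀} {w₁} {w₂} {w₃} e₀₁ e₁₂ e₂₃ =
      Sum.map (λ (c₀ , c₂) → centre-unique {w₀} {w₂} c₀ c₂ (trans (edge-block {w₀} {w₁} e₀₁) (edge-block {w₁} {w₂} e₁₂)))
              (λ (c₁ , c₃) → centre-unique {w₁} {w₃} c₁ c₃ (trans (edge-block {w₁} {w₂} e₁₂) (edge-block {w₂} {w₃} e₂₃)))
              (alternating (edge-centre {w₀} {w₁} e₀₁) (edge-centre {w₁} {w₂} e₁₂) (edge-centre {w₂} {w₃} e₂₃))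

  private
    in-block : ∀ {b x} → block x ≡ b → toℕ x ≡ toℕ x % suc (suc k) + b * suc (suc k)
    in-block {x = x} refl = toℕ≡%+block* x

    Unique-Fin-interval-≤ : ∀ {xs : List (Fin m)} lo len → Unique xs → All (λ x → lo ≤ toℕ x × toℕ x < lo + len) xs →
      length xs ≤ len
    Unique-Fin-interval-≤ {xs} lo len u inside = subst (_≤ len) (length-map toℕ xs)
      (Unique-interval-≤ lo len (Unique.map⁺ toℕ-injective u) (map⁺ inside))

  module _ {S : List (Fin m)} (uS : Unique S) (sparse : All (λ v → degIn starForest S v ≤ k) S) where

    block-count-≤-centred : ∀ {c} → c ∈ S → T (centre c) → count-at block (block c) S ≤ suc k
    block-count-≤-centred {c} c∈ cc =
      ≤-trans (Unique⇒length-≤ (Unique.filter⁺ (λ x → block x ≟ℕ block c) uS) block⊆) (s≤s (All.lookup sparse c∈))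
      where
      block⊆ : filter (λ x → block x ≟ℕ block c) S ⊆ c ∷ filter (T? ∘ adj starForest c) S
      block⊆ {x} x∈ with ∈-filter⁻ (λ x → block x ≟ℕ block c) {xs = S} x∈ | x ≟ c
      ... | _     , _     | yes refl = here refl
      ... | x∈S , bx≡bc | no x≢c   = there (∈-neighbours starForest {v = c} x∈S (centre-adj cc (sym bx≡bc) x≢c))

    block-count-≤-uncentred : ∀ b → All (¬_ ∘ T ∘ centre) (filter (λ x → block x ≟ℕ b) S) → count-at block b S ≤ suc k
    block-count-≤-uncentred b uncentred =
      Unique-Fin-interval-≤ (suc (b * suc (suc k))) (suc k) (Unique.filter⁺ (λ x → block x ≟ℕ b) uS)
        (All.tabulate λ {x} x∈ → inside x (proj₂ (∈-filter⁻ (λ x → block x ≟ℕ b) {xs = S} x∈)) (All.lookup uncentred x∈))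
      where
      inside : ∀ x → block x ≡ b → ¬ T (centre x) →
        suc (b * suc (suc k)) ≤ toℕ x × toℕ x < suc (b * suc (suc k)) + suc k
      inside x bx≡b ¬cx = subst (suc (b * suc (suc k)) ≤_) (sym (in-block bx≡b)) (+-monoˡ-≤ _ 0<r)
                        , subst (_< suc (b * suc (suc k)) + suc k) (sym (in-block bx≡b))
                            (s≤s (subst (r + b * suc (suc k) ≤_) (+-comm (suc k) _) (+-monoˡ-≤ _ (≤-pred (m%n<n (toℕ x) (suc (suc k)))))))
        where
        r = toℕ x % suc (suc k)
        0<r : 0 < r
        0<r = n≢0⇒n>0 (¬cx ∘ ≡⇒≡ᵇ r 0)

    block-count-≤ : ∀ b → count-at block b S ≤ suc k
    block-count-≤ b with any? (T? ∘ centre) (filter (λ x → block x ≟ℕ b) S)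
    ... | yes centred = let c , c∈ , cc = find centred
                            c∈S , bc≡b = ∈-filter⁻ (λ x → block x ≟ℕ b) {xs = S} c∈
                        in subst (λ b → count-at block b S ≤ suc k) bc≡b (block-count-≤-centred c∈S cc)
    ... | no uncentred = block-count-≤-uncentred b (¬Any⇒All¬ _ uncentred)

    last-block-count-≤ : count-at block (m / suc (suc k)) S ≤ m % suc (suc k)
    last-block-count-≤ =
      Unique-Fin-interval-≤ (q * suc (suc k)) (m % suc (suc k)) (Unique.filter⁺ (λ x → block x ≟ℕ q) uS)
        (All.tabulate λ {x} x∈ → inside x (proj₂ (∈-filter⁻ (λ x → block x ≟ℕ q) {xs = S} x∈)))
      where
      q = m / suc (suc k)
      inside : ∀ x → block x ≡ q → q * suc (suc k) ≤ toℕ x × toℕ x < q * suc (suc k) + m % suc (suc k)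
      inside x bx≡q = subst (q * suc (suc k) ≤_) (sym (in-block bx≡q)) (m≤n+m _ _)
                    , subst (toℕ x <_) (trans (m≡m%n+[m/n]*n m (suc (suc k))) (+-comm (m % suc (suc k)) (q * suc (suc k)))) (toℕ<n x)

    starForest-sparse-≤ : length S ≤ m / suc (suc k) * suc k + m % suc (suc k)
    starForest-sparse-≤ = begin
      length S                                                     ≡⟨ count-below-all block S (All.tabulate (λ {x} _ → s≤s (/-monoˡ-≤ (suc (suc k)) (<⇒≤ (toℕ<n x))))) ⟨
      count-below block (suc q) S                                  ≡⟨ count-below-suc block q S ⟩
      count-below block q S + count-at block q S                   ≤⟨ +-mono-≤ (count-below-≤ block q S (λ c _ → block-count-≤ c)) last-block-count-≤ ⟩
      q * suc k + m % suc (suc k)                                  ∎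
      where
      open ≤-Reasoning
      q = m / suc (suc k)

[1+m+m/[1+n]]/[2+n]≡m/[1+n] : ∀ m n → (suc m + m / suc n) / suc (suc n) ≡ m / suc n
[1+m+m/[1+n]]/[2+n]≡m/[1+n] m n = begin
  (suc m + q) / suc (suc n)                     ≡⟨ cong (λ x → (suc x + q) / suc (suc n)) (m≡m%n+[m/n]*n m (suc n)) ⟩
  (suc (r + q * suc n) + q) / suc (suc n)       ≡⟨ cong (_/ suc (suc n)) (regroup r q n) ⟩
  (suc r + q * suc (suc n)) / suc (suc n)       ≡⟨ +-distrib-/-∣ʳ (suc r) (divides-refl q) ⟩
  suc r / suc (suc n) + q * suc (suc n) / suc (suc n) ≡⟨ cong₂ _+_ (m<n⇒m/n≡0 (s≤s (m%n<n m (suc n)))) (m*n/n≡m q (suc (suc n))) ⟩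
  q                                             ∎
  where
  open ≡-Reasoning
  q = m / suc n
  r = m % suc n
  regroup : ∀ r q n → suc (r + q * suc n) + q ≡ suc r + q * suc (suc n)
  regroup = solve-∀

m/[2+n]*[1+n]+m%[2+n]≤j : ∀ {m j} n → m < suc j + j / suc n → m / suc (suc n) * suc n + m % suc (suc n) ≤ j
m/[2+n]*[1+n]+m%[2+n]≤j {m} {j} n m<N with m / suc (suc n) <? j / suc n
... | yes p<q = begin
  p * suc n + s   ≤⟨ +-monoʳ-≤ (p * suc n) (≤-pred (m%n<n m (suc (suc n)))) ⟩
  p * suc n + suc n ≡⟨ +-comm (p * suc n) (suc n) ⟩
  suc p * suc n   ≤⟨ *-monoˡ-≤ (suc n) p<q ⟩
  q * suc n       ≤⟨ m/n*n≤m j (suc n) ⟩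
  j               ∎
  where
  open ≤-Reasoning
  p = m / suc (suc n)
  q = j / suc n
  s = m % suc (suc n)
... | no p≮q = +-cancelʳ-≤ p (p * suc n + s) j (begin
  (p * suc n + s) + p ≡⟨ regroup s p n ⟩
  s + p * suc (suc n) ≡⟨ m≡m%n+[m/n]*n m (suc (suc n)) ⟨
  m                   ≤⟨ ≤-pred m<N ⟩
  j + q               ≤⟨ +-monoʳ-≤ j (≮⇒≥ p≮q) ⟩
  j + p               ∎)
  where
  open ≤-Reasoning
  p = m / suc (suc n)
  q = j / suc n
  s = m % suc (suc n)
  regroup : ∀ s p n → (p * suc n + s) + p ≡ s + p * suc (suc n)
  regroup = solve-∀

open StarForest using (starForest; starForest-isForest; starForest-sparse-≤)

theorem3p2 : (k i j : ℕ) → 1 ≤ k → k + 3 ≤ i → k + 2 ≤ j →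
    RamseyForestEq k i j (j + (j ∸ 1) / suc k)
theorem3p2 k i zero    _ _    k+2≤0 = contradiction (≤-trans (m≤n+m 2 k) k+2≤0) λ ()
theorem3p2 k i (suc j) _ k+3≤i _    = upper , lower
  where
  upper : RamseyProp k i (suc j) (suc j + j / suc k)
  upper G forest with forest-sparse-set forest k
  ... | K , uK , sparse , N≤ = inj₂ (take (suc j) K , sparse-set-take {G = G} (suc j) uK sparse
          (+-cancelʳ-≤ (j / suc k) (suc j) (length K)
            (subst (λ x → suc j + j / suc k ≤ length K + x) ([1+m+m/[1+n]]/[2+n]≡m/[1+n] j k) N≤)))

  lower : ∀ m → m < suc j + j / suc k → ¬ RamseyProp k i (suc j) m
  lower m m<N ramsey with ramsey (starForest k m) (starForest-isForest k m)
  ... | inj₁ (_ , dense) =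
        <⇒≱ (subst (_≤ i) (+-comm k 3) k+3≤i) (forest-dense-set-≤ (starForest-isForest k m) dense)
  ... | inj₂ (_ , (uS , |S|≡1+j) , sparse) =
        <⇒≱ (s≤s (m/[2+n]*[1+n]+m%[2+n]≤j k m<N)) (subst (_≤ _) |S|≡1+j (starForest-sparse-≤ k m uS sparse))
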